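{- Let $G=(V,E_G)$ be the rectangular grid graph with vertices $(x,y)$, $1\le x\le n$, $1\le y\le m$, adjacent iff they differ by $1$ in exactly one coordinate. Let $E=(x_E,y_E)$, $F=(x_F,y_F)\in V$ satisfy: $x_F\le x_E$, $y_E\le y_F$, $x_E-x_F\le y_F-y_E$; $x_F\ne x_E$; ${\rm Gain}'\ge 2$, where ${\rm Gain}'=\max\big(0,\big||y_F-y_E|-|x_E-x_F|\big|-1\big)$; and neither $E$ nor $F$ lies on the boundary of the grid. Let $G'=(V,E_G\cup\{EF\})$ and $\beta_0=\frac{1+y_F+y_E+x_E-x_F}{2}$. If ${\rm Gain}'$ is odd, then $\{(1,\lfloor\beta_0\rfloor),\,(n,\lfloor\beta_0\rfloor),\,(n,1)\}$ is a resolving set of $G'$.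
   Context: For a connected graph $H$, a set $R$ of vertices is resolving if every pair of distinct vertices $A\ne B$ has some $X\in R$ with $d_H(A,X)\ne d_H(B,X)$, where $d_H$ is shortest-path distance. -}

module Defs where

open import Data.Nat using (ℕ; zero; suc; _+_; _∸_; _≤_; _<_; ∣_-_∣)
open import Data.Nat.DivMod using (_/_)
open import Data.Product using (_×_; _,_; ∃; ∃-syntax)
open import Data.Sum using (_⊎_)
open import Data.List using (List)
open import Data.List.Membership.Propositional using (_∈_)
open import Relation.Binary.PropositionalEquality using (_≡_; _≢_)

Point : Set
Point = ℕ × ℕ

InGrid : ℕ → ℕ → Point → Set
InGrid n m (x , y) = (1 ≤ x × x ≤ n) × (1 ≤ y × y ≤ m)

Interior : ℕ → ℕ → Point → Set
Interior n m (x , y) = (1 < x × x < n) × (1 < y × y < m)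

GridAdj : Point → Point → Set
GridAdj (x , y) (x' , y') =
  (x ≡ x' × (suc y ≡ y' ⊎ suc y' ≡ y)) ⊎ (y ≡ y' × (suc x ≡ x' ⊎ suc x' ≡ x))

Adj' : ℕ → ℕ → Point → Point → Point → Point → Set
Adj' n m E F u v =
  InGrid n m u × InGrid n m v ×
  (GridAdj u v ⊎ ((u ≡ E × v ≡ F) ⊎ (u ≡ F × v ≡ E)))

data Walk (n m : ℕ) (E F : Point) : ℕ → Point → Point → Set where
  here : ∀ {u} → InGrid n m u → Walk n m E F 0 u u
  step : ∀ {k u v w} → Adj' n m E F u v → Walk n m E F k v w →
         Walk n m E F (suc k) u w

Dist : ℕ → ℕ → Point → Point → Point → Point → ℕ → Set
Dist n m E F u w k =
  Walk n m E F k u w × (∀ j → Walk n m E F j u w → k ≤ j)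

Resolving : ℕ → ℕ → Point → Point → List Point → Set
Resolving n m E F R =
  ∀ A B → InGrid n m A → InGrid n m B → A ≢ B →
  ∃[ X ] (X ∈ R × ∃[ k₁ ] ∃[ k₂ ]
    (Dist n m E F A X k₁ × Dist n m E F B X k₂ × k₁ ≢ k₂))

-- Gain' = max(0, | |y_F - y_E| - |x_E - x_F| | - 1)  (truncated subtraction = max with 0)
Gain' : Point → Point → ℕ
Gain' (xE , yE) (xF , yF) = ∣ ∣ yF - yE ∣ - ∣ xE - xF ∣ ∣ ∸ 1

-- ⌊β₀⌋ with β₀ = (1 + y_F + y_E + x_E - x_F)/2 (used when x_F ≤ x_E)
floorβ₀ : Point → Point → ℕ
floorβ₀ (xE , yE) (xF , yF) = (1 + yF + yE + (xE ∸ xF)) / 2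

-- In G' a shortest walk uses the edge EF at most once, so the distance is the
-- minimum d' of the grid distance d₁ and the two detours through EF; a
-- potential argument shows that no walk is shorter, since d'(·, X) changes by at
-- most one along each edge. Oddness of Gain' makes
-- (y_F − y_E) − (x_E − x_F) = 2k even, so E and F have the same colour in the
-- chessboard colouring and a detour through EF always has the parity opposite
-- to the direct route. The landmark X₂ = (n, ⌊β₀⌋) is equidistant from E and F,
-- so equal distances to X₂ force equal colours, and then equal distances to
-- X₁ = (1, ⌊β₀⌋) or to X₃ = (n, 1) are realised by routes of the same kind.
-- Only the detour E → F can reach X₁ and only F → E can reach X₃, never both
-- from one vertex; in each remaining case two landmarks on a common row or
-- column recover both coordinates.
module Submission where

open import Defs
open import Data.Nat using (ℕ; zero; suc; _+_; _*_; _∸_; _≤_; _<_; _%_; _/_; _⊓_; ∣_-_∣; z≤n; s≤s; _≟_; _≤?_)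
open import Data.Nat.Properties
open import Data.Nat.DivMod using (%-distribˡ-+; [m+kn]%n≡m%n; m≡m%n+[m/n]*n; +-distrib-/-∣ʳ; m*n/n≡m)
open import Data.Nat.Divisibility using (n∣m*n)
open import Data.Nat.Tactic.RingSolver using (solve-∀)
open import Algebra.Properties.CommutativeSemigroup +-commutativeSemigroup using (interchange)
open import Data.Product using (_×_; _,_; proj₁; Σ-syntax)
open import Data.Sum using (_⊎_; inj₁; inj₂)
open import Data.Empty using (⊥; ⊥-elim)
open import Data.List using (_∷_; [])
open import Data.List.Relation.Unary.All using (All; _∷_; []; lookup)
open import Data.List.Relation.Unary.All.Properties using (¬All⇒Any¬)
open import Data.List.Membership.Propositional using (find)
open import Function using (_∘_)
open import Relation.Binary.Definitions using (tri<; tri≈; tri>)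
open import Relation.Nullary using (¬_; yes; no; contradiction)
open import Relation.Binary.PropositionalEquality
open import Relation.Binary.Structures using (IsEquivalence)
open import Relation.Binary.Bundles using (Setoid)
open import Level using (0ℓ)
import Relation.Binary.Reasoning.Setoid as SetoidReasoning

-- Parity

infix 4 _≡₂_

record _≡₂_ (s t : ℕ) : Set where
  constructor same-parity
  field %2-≡ : s % 2 ≡ t % 2

≡₂-isEquivalence : IsEquivalence _≡₂_
≡₂-isEquivalence = record
  { refl  = same-parity refl
  ; sym   = λ (same-parity eq) → same-parity (sym eq)
  ; trans = λ (same-parity eq) (same-parity eq′) → same-parity (trans eq eq′)
  }

≡₂-setoid : Setoid 0ℓ 0ℓ
≡₂-setoid = record { isEquivalence = ≡₂-isEquivalence }

open IsEquivalence ≡₂-isEquivalence using () renaming (refl to ≡₂-refl; sym to ≡₂-sym; trans to ≡₂-trans)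

module ≡₂-Reasoning = SetoidReasoning ≡₂-setoid

≡⇒≡₂ : ∀ {s t} → s ≡ t → s ≡₂ t
≡⇒≡₂ refl = ≡₂-refl

≡₂-+ : ∀ {s t u v} → s ≡₂ t → u ≡₂ v → s + u ≡₂ t + v
≡₂-+ {s} {t} {u} {v} (same-parity s≡t) (same-parity u≡v) = same-parity (begin
  (s + u) % 2           ≡⟨ %-distribˡ-+ s u 2 ⟩
  (s % 2 + u % 2) % 2   ≡⟨ cong₂ (λ i j → (i + j) % 2) s≡t u≡v ⟩
  (t % 2 + v % 2) % 2   ≡⟨ %-distribˡ-+ t v 2 ⟨
  (t + v) % 2           ∎)
  where open ≡-Reasoning

≡₂-suc : ∀ {s t} → s ≡₂ t → suc s ≡₂ suc t
≡₂-suc = ≡₂-+ {1} ≡₂-refl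

+-double-≡₂ : ∀ s u → s + (u + u) ≡₂ s
+-double-≡₂ s u = same-parity (trans (cong (λ z → (s + z) % 2) (u+u≡u*2 u)) ([m+kn]%n≡m%n s u 2))
  where
  u+u≡u*2 : ∀ u → u + u ≡ u * 2
  u+u≡u*2 = solve-∀

≡₂-+-cancelʳ : ∀ {s t} u → s + u ≡₂ t + u → s ≡₂ t
≡₂-+-cancelʳ {s} {t} u eq = begin
  s               ≈⟨ +-double-≡₂ s u ⟨
  s + (u + u)     ≡⟨ +-assoc s u u ⟨
  s + u + u       ≈⟨ ≡₂-+ eq ≡₂-refl ⟩
  t + u + u       ≡⟨ +-assoc t u u ⟩
  t + (u + u)     ≈⟨ +-double-≡₂ t u ⟩
  t               ∎
  where open ≡₂-Reasoning

suc-≢₂ : ∀ s → ¬ suc s ≡₂ s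
suc-≢₂ zero (same-parity ())
suc-≢₂ (suc zero) (same-parity ())
suc-≢₂ (suc (suc s)) (same-parity eq) = suc-≢₂ s (same-parity eq)

∣-∣-≡₂-+ : ∀ u v → ∣ u - v ∣ ≡₂ u + v
∣-∣-≡₂-+ zero v = ≡₂-refl
∣-∣-≡₂-+ (suc u) zero = ≡⇒≡₂ (sym (+-identityʳ (suc u)))
∣-∣-≡₂-+ (suc u) (suc v) =
  same-parity (trans (_≡₂_.%2-≡ (∣-∣-≡₂-+ u v)) (cong (λ z → suc z % 2) (sym (+-suc u v))))

-- Absolute differences

+-double-injective : ∀ {u v} → u + u ≡ v + v → u ≡ v
+-double-injective {u} {v} eq with <-cmp u v
... | tri< u<v _ _ = contradiction eq (<⇒≢ (+-mono-< u<v u<v))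
... | tri≈ _ u≡v _ = u≡v
... | tri> _ _ v<u = contradiction eq (>⇒≢ (+-mono-< v<u v<u))

∣x-l∣+∣x-h∣≡∣l-h∣ : ∀ {l x h} → l ≤ x → x ≤ h → ∣ x - l ∣ + ∣ x - h ∣ ≡ ∣ l - h ∣
∣x-l∣+∣x-h∣≡∣l-h∣ {zero} {x} {h} _ x≤h = begin
  ∣ x - 0 ∣ + ∣ x - h ∣   ≡⟨ cong₂ _+_ (∣-∣-identityʳ x) (m≤n⇒∣m-n∣≡n∸m x≤h) ⟩
  x + (h ∸ x)             ≡⟨ m+[n∸m]≡n x≤h ⟩
  h                       ∎
  where open ≡-Reasoning
∣x-l∣+∣x-h∣≡∣l-h∣ {suc l} {suc x} {suc h} (s≤s l≤x) (s≤s x≤h) = ∣x-l∣+∣x-h∣≡∣l-h∣ l≤x x≤h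

∣-∣-cancel-≥ : ∀ {u v o} → o ≤ u → o ≤ v → ∣ u - o ∣ ≡ ∣ v - o ∣ → u ≡ v
∣-∣-cancel-≥ {u} {v} {o} o≤u o≤v eq = begin
  u            ≡⟨ m∸n+n≡m o≤u ⟨
  u ∸ o + o    ≡⟨ cong (_+ o) u∸o≡v∸o ⟩
  v ∸ o + o    ≡⟨ m∸n+n≡m o≤v ⟩
  v            ∎
  where
  open ≡-Reasoning
  u∸o≡v∸o : u ∸ o ≡ v ∸ o
  u∸o≡v∸o = trans (sym (m≤n⇒∣n-m∣≡n∸m o≤u)) (trans eq (m≤n⇒∣n-m∣≡n∸m o≤v))

∣-∣-cancel-≤ : ∀ {u v o} → u ≤ o → v ≤ o → ∣ u - o ∣ ≡ ∣ v - o ∣ → u ≡ v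
∣-∣-cancel-≤ {u} {v} {o} u≤o v≤o eq = begin
  u              ≡⟨ m∸[m∸n]≡n u≤o ⟨
  o ∸ (o ∸ u)    ≡⟨ cong (o ∸_) o∸u≡o∸v ⟩
  o ∸ (o ∸ v)    ≡⟨ m∸[m∸n]≡n v≤o ⟩
  v              ∎
  where
  open ≡-Reasoning
  o∸u≡o∸v : o ∸ u ≡ o ∸ v
  o∸u≡o∸v = trans (sym (m≤n⇒∣m-n∣≡n∸m u≤o)) (trans eq (m≤n⇒∣m-n∣≡n∸m v≤o))

∣m+n-m∣≡n : ∀ m n → ∣ m + n - m ∣ ≡ n
∣m+n-m∣≡n m n = trans (∣-∣-comm (m + n) m) (∣m-m+n∣≡n m n)

∣n-1+n∣≡1 : ∀ n → ∣ n - suc n ∣ ≡ 1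
∣n-1+n∣≡1 zero = refl
∣n-1+n∣≡1 (suc n) = ∣n-1+n∣≡1 n

∣m-o∣≡p∧o<p⇒m≡o+p : ∀ {m o p} → ∣ m - o ∣ ≡ p → o < p → m ≡ o + p
∣m-o∣≡p∧o<p⇒m≡o+p {zero} refl o<o = contradiction o<o (<-irrefl refl)
∣m-o∣≡p∧o<p⇒m≡o+p {suc m} {zero} eq _ = eq
∣m-o∣≡p∧o<p⇒m≡o+p {suc m} {suc o} eq o<p = cong suc (∣m-o∣≡p∧o<p⇒m≡o+p eq (<-trans (n<1+n o) o<p))

∣m-o∣≡∣n-o∣⇒m≡n⊎m+n≡o+o : ∀ m n o → ∣ m - o ∣ ≡ ∣ n - o ∣ → m ≡ n ⊎ m + n ≡ o + o
∣m-o∣≡∣n-o∣⇒m≡n⊎m+n≡o+o m n zero eq =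
  inj₁ (trans (sym (∣-∣-identityʳ m)) (trans eq (∣-∣-identityʳ n)))
∣m-o∣≡∣n-o∣⇒m≡n⊎m+n≡o+o zero zero (suc o) eq = inj₁ refl
∣m-o∣≡∣n-o∣⇒m≡n⊎m+n≡o+o zero (suc n) (suc o) eq =
  inj₂ (cong suc (∣m-o∣≡p∧o<p⇒m≡o+p (sym eq) (n<1+n o)))
∣m-o∣≡∣n-o∣⇒m≡n⊎m+n≡o+o (suc m) zero (suc o) eq =
  inj₂ (trans (+-identityʳ (suc m)) (cong suc (∣m-o∣≡p∧o<p⇒m≡o+p eq (n<1+n o))))
∣m-o∣≡∣n-o∣⇒m≡n⊎m+n≡o+o (suc m) (suc n) (suc o) eq with ∣m-o∣≡∣n-o∣⇒m≡n⊎m+n≡o+o m n o eq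
... | inj₁ m≡n = inj₁ (cong suc m≡n)
... | inj₂ m+n≡o+o = inj₂ (cong suc (trans (+-suc m n) (trans (cong suc m+n≡o+o) (sym (+-suc o o)))))

two-centres-injective : ∀ {p q y y′} → p < q →
  ∣ y - p ∣ ≡ ∣ y′ - p ∣ → ∣ y - q ∣ ≡ ∣ y′ - q ∣ → y ≡ y′
two-centres-injective {p} {q} {y} {y′} p<q eqᵖ eqᵠ
  with ∣m-o∣≡∣n-o∣⇒m≡n⊎m+n≡o+o y y′ p eqᵖ | ∣m-o∣≡∣n-o∣⇒m≡n⊎m+n≡o+o y y′ q eqᵠ
... | inj₁ y≡y′ | _ = y≡y′
... | inj₂ _ | inj₁ y≡y′ = y≡y′
... | inj₂ y+y′≡p+p | inj₂ y+y′≡q+q =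
  contradiction (trans (sym y+y′≡p+p) y+y′≡q+q) (<⇒≢ (+-mono-< p<q p<q))

pairwise-sums-injective : ∀ {p q v p′ q′ v′} →
  p + q ≡ p′ + q′ → p + v ≡ p′ + v′ → q + v ≡ q′ + v′ → p ≡ p′ × v ≡ v′
pairwise-sums-injective {p} {q} {v} {p′} {q′} {v′} eqᵖᵠ eqᵖᵛ eqᵠᵛ =
  +-cancelʳ-≡ v p p′ (trans eqᵖᵛ (cong (p′ +_) (sym v≡v′))) , v≡v′
  where
  regroup : ∀ p q v → (p + v) + (q + v) ≡ (p + q) + (v + v)
  regroup = solve-∀
  v≡v′ : v ≡ v′
  v≡v′ = +-double-injective (+-cancelˡ-≡ (p + q) _ _ (begin
    (p + q) + (v + v)       ≡⟨ regroup p q v ⟨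
    (p + v) + (q + v)       ≡⟨ cong₂ _+_ eqᵖᵛ eqᵠᵛ ⟩
    (p′ + v′) + (q′ + v′)   ≡⟨ regroup p′ q′ v′ ⟩
    (p′ + q′) + (v′ + v′)   ≡⟨ cong (_+ (v′ + v′)) eqᵖᵠ ⟨
    (p + q) + (v′ + v′)     ∎))
    where open ≡-Reasoning

+-comm-≡ : ∀ p q p′ q′ → p + q ≡ p′ + q′ → q + p ≡ q′ + p′
+-comm-≡ p q p′ q′ eq = trans (+-comm q p) (trans eq (+-comm p′ q′))

segment-landmarks : ∀ {l h x x′ v v′} → l ≤ x → x ≤ h → l ≤ x′ → x′ ≤ h →
  ∣ x - l ∣ + v ≡ ∣ x′ - l ∣ + v′ → ∣ x - h ∣ + v ≡ ∣ x′ - h ∣ + v′ → x ≡ x′ × v ≡ v′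
segment-landmarks l≤x x≤h l≤x′ x′≤h eqˡ eqʰ
  with pairwise-sums-injective (trans (∣x-l∣+∣x-h∣≡∣l-h∣ l≤x x≤h) (sym (∣x-l∣+∣x-h∣≡∣l-h∣ l≤x′ x′≤h))) eqˡ eqʰ
... | ∣x-l∣≡∣x′-l∣ , v≡v′ = ∣-∣-cancel-≥ l≤x l≤x′ ∣x-l∣≡∣x′-l∣ , v≡v′

-- The grid metric and the chessboard colouring

d₁ : Point → Point → ℕ
d₁ (x , y) (x′ , y′) = ∣ x - x′ ∣ + ∣ y - y′ ∣

colour : Point → ℕ
colour (x , y) = x + y

d₁-self : ∀ A → d₁ A A ≡ 0
d₁-self (x , y) = cong₂ _+_ (∣n-n∣≡0 x) (∣n-n∣≡0 y)

d₁-triangle : ∀ A P X → d₁ A X ≤ d₁ A P + d₁ P X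
d₁-triangle (x , y) (p , q) (x′ , y′) = begin
  ∣ x - x′ ∣ + ∣ y - y′ ∣                                  ≤⟨ +-mono-≤ (∣-∣-triangle x p x′) (∣-∣-triangle y q y′) ⟩
  (∣ x - p ∣ + ∣ p - x′ ∣) + (∣ y - q ∣ + ∣ q - y′ ∣)      ≡⟨ interchange ∣ x - p ∣ ∣ p - x′ ∣ ∣ y - q ∣ ∣ q - y′ ∣ ⟩
  (∣ x - p ∣ + ∣ y - q ∣) + (∣ p - x′ ∣ + ∣ q - y′ ∣)      ∎
  where open ≤-Reasoning

d₁-adjacent : ∀ {u v} → GridAdj u v → d₁ u v ≡ 1
d₁-adjacent {x , y} (inj₁ (refl , inj₁ refl)) = cong₂ _+_ (∣n-n∣≡0 x) (∣n-1+n∣≡1 y)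
d₁-adjacent {x , suc y} (inj₁ (refl , inj₂ refl)) =
  cong₂ _+_ (∣n-n∣≡0 x) (trans (∣-∣-comm (suc y) y) (∣n-1+n∣≡1 y))
d₁-adjacent {x , y} (inj₂ (refl , inj₁ refl)) = cong₂ _+_ (∣n-1+n∣≡1 x) (∣n-n∣≡0 y)
d₁-adjacent {suc x , y} (inj₂ (refl , inj₂ refl)) =
  cong₂ _+_ (trans (∣-∣-comm (suc x) x) (∣n-1+n∣≡1 x)) (∣n-n∣≡0 y)

d₁-step : ∀ {u v} → GridAdj u v → ∀ X → d₁ u X ≤ suc (d₁ v X)
d₁-step {u} {v} uv X = subst (λ k → d₁ u X ≤ k + d₁ v X) (d₁-adjacent uv) (d₁-triangle u v X)

d₁-≡₂-colour : ∀ A X → d₁ A X ≡₂ colour A + colour X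
d₁-≡₂-colour (x , y) (x′ , y′) =
  ≡₂-trans (≡₂-+ (∣-∣-≡₂-+ x x′) (∣-∣-≡₂-+ y y′)) (≡⇒≡₂ (interchange x x′ y y′))

d₁-equal⇒same-colour : ∀ {A B X} → d₁ A X ≡ d₁ B X → colour A ≡₂ colour B
d₁-equal⇒same-colour {A} {B} {X} eq = ≡₂-+-cancelʳ (colour X) (begin
  colour A + colour X   ≈⟨ d₁-≡₂-colour A X ⟨
  d₁ A X                ≡⟨ eq ⟩
  d₁ B X                ≈⟨ d₁-≡₂-colour B X ⟩
  colour B + colour X   ∎)
  where open ≡₂-Reasoning

-- Detours through an extra edge

via : Point → Point → Point → Point → ℕ
via P Q A X = d₁ A P + suc (d₁ Q X)

d₁≤via : ∀ P Q A X → d₁ Q X ≤ via P Q A X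
d₁≤via P Q A X = ≤-trans (n≤1+n _) (m≤n+m (suc (d₁ Q X)) (d₁ A P))

d₁<via : ∀ P Q A X → d₁ P X ≤ d₁ Q X → d₁ A X < via P Q A X
d₁<via P Q A X P≤Q = begin-strict
  d₁ A X                 ≤⟨ d₁-triangle A P X ⟩
  d₁ A P + d₁ P X        ≤⟨ +-monoʳ-≤ (d₁ A P) P≤Q ⟩
  d₁ A P + d₁ Q X        <⟨ +-monoʳ-< (d₁ A P) (n<1+n (d₁ Q X)) ⟩
  d₁ A P + suc (d₁ Q X)  ∎
  where open ≤-Reasoning

via-≡₂ : ∀ P Q → colour P ≡₂ colour Q → ∀ A X → via P Q A X ≡₂ suc (colour A + colour X)
via-≡₂ P Q P≡Q A X = begin
  d₁ A P + suc (d₁ Q X)                             ≈⟨ ≡₂-+ (d₁-≡₂-colour A P) (≡₂-suc (d₁-≡₂-colour Q X)) ⟩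
  (colour A + colour P) + suc (colour Q + colour X) ≈⟨ ≡₂-+ (≡₂-+ {colour A} ≡₂-refl P≡Q) ≡₂-refl ⟩
  (colour A + colour Q) + suc (colour Q + colour X) ≡⟨ regroup (colour A) (colour Q) (colour X) ⟩
  suc (colour A + colour X) + (colour Q + colour Q) ≈⟨ +-double-≡₂ _ (colour Q) ⟩
  suc (colour A + colour X)                         ∎
  where
  open ≡₂-Reasoning
  regroup : ∀ a q x → (a + q) + suc (q + x) ≡ suc (a + x) + (q + q)
  regroup = solve-∀

d₁≢via : ∀ {P Q A B X} → colour P ≡₂ colour Q → colour A ≡₂ colour B → d₁ A X ≢ via P Q B X
d₁≢via {P} {Q} {A} {B} {X} P≡Q A≡B eq = suc-≢₂ (colour A + colour X) (begin
  suc (colour A + colour X)   ≈⟨ ≡₂-suc (≡₂-+ A≡B (≡₂-refl {colour X})) ⟩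
  suc (colour B + colour X)   ≈⟨ via-≡₂ P Q P≡Q B X ⟨
  via P Q B X                 ≡⟨ eq ⟨
  d₁ A X                      ≈⟨ d₁-≡₂-colour A X ⟩
  colour A + colour X         ∎)
  where open ≡₂-Reasoning

-- Walks in G'

GridAdj-sym : ∀ {u v} → GridAdj u v → GridAdj v u
GridAdj-sym (inj₁ (eq , inj₁ s)) = inj₁ (sym eq , inj₂ s)
GridAdj-sym (inj₁ (eq , inj₂ s)) = inj₁ (sym eq , inj₁ s)
GridAdj-sym (inj₂ (eq , inj₁ s)) = inj₂ (sym eq , inj₂ s)
GridAdj-sym (inj₂ (eq , inj₂ s)) = inj₂ (sym eq , inj₁ s)

module Walks (n m : ℕ) (E F : Point) where

  Adj'-sym : ∀ {u v} → Adj' n m E F u v → Adj' n m E F v u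
  Adj'-sym (u∈G , v∈G , inj₁ uv) = v∈G , u∈G , inj₁ (GridAdj-sym uv)
  Adj'-sym (u∈G , v∈G , inj₂ (inj₁ (u≡E , v≡F))) = v∈G , u∈G , inj₂ (inj₂ (v≡F , u≡E))
  Adj'-sym (u∈G , v∈G , inj₂ (inj₂ (u≡F , v≡E))) = v∈G , u∈G , inj₂ (inj₁ (v≡E , u≡F))

  infixr 5 _++ᵂ_

  _++ᵂ_ : ∀ {k j u v w} → Walk n m E F k u v → Walk n m E F j v w → Walk n m E F (k + j) u w
  here _ ++ᵂ q = q
  step uv p ++ᵂ q = step uv (p ++ᵂ q)

  reverse : ∀ {k u w} → Walk n m E F k u w → Walk n m E F k w u
  reverse (here u∈G) = here u∈G
  reverse {w = w} (step {k} {u} uv p) =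
    subst (λ j → Walk n m E F j w u) (+-comm k 1) (reverse p ++ᵂ step (Adj'-sym uv) (here (proj₁ uv)))

  leftward : ∀ t {x y} → InGrid n m (x , y) → t + x ≤ n → Walk n m E F t (t + x , y) (x , y)
  leftward zero x∈G _ = here x∈G
  leftward (suc t) {x} x∈G@((1≤x , _) , y∈G) t+x<n =
    step (((s≤s z≤n , t+x<n) , y∈G) , ((≤-trans 1≤x (m≤n+m x t) , <⇒≤ t+x<n) , y∈G) , inj₁ (inj₂ (refl , inj₂ refl)))
         (leftward t x∈G (<⇒≤ t+x<n))

  downward : ∀ t {x y} → InGrid n m (x , y) → t + y ≤ m → Walk n m E F t (x , t + y) (x , y)
  downward zero y∈G _ = here y∈G
  downward (suc t) {y = y} y∈G@(x∈G , (1≤y , _)) t+y<m =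
    step ((x∈G , (s≤s z≤n , t+y<m)) , (x∈G , (≤-trans 1≤y (m≤n+m y t) , <⇒≤ t+y<m)) , inj₁ (inj₁ (refl , inj₂ refl)))
         (downward t y∈G (<⇒≤ t+y<m))

  row-descent : ∀ {x x′ y} → InGrid n m (x , y) → InGrid n m (x′ , y) → x′ ≤ x →
                Walk n m E F ∣ x - x′ ∣ (x , y) (x′ , y)
  row-descent {x} {x′} {y} ((_ , x≤n) , _) x′∈G x′≤x =
    subst₂ (λ k z → Walk n m E F k (z , y) (x′ , y)) (sym (m≤n⇒∣n-m∣≡n∸m x′≤x)) (m∸n+n≡m x′≤x)
      (leftward (x ∸ x′) x′∈G (subst (_≤ n) (sym (m∸n+n≡m x′≤x)) x≤n))

  column-descent : ∀ {x y y′} → InGrid n m (x , y) → InGrid n m (x , y′) → y′ ≤ y →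
                   Walk n m E F ∣ y - y′ ∣ (x , y) (x , y′)
  column-descent {x} {y} {y′} (_ , (_ , y≤m)) y′∈G y′≤y =
    subst₂ (λ k z → Walk n m E F k (x , z) (x , y′)) (sym (m≤n⇒∣n-m∣≡n∸m y′≤y)) (m∸n+n≡m y′≤y)
      (downward (y ∸ y′) y′∈G (subst (_≤ m) (sym (m∸n+n≡m y′≤y)) y≤m))

  row-walk : ∀ {x x′ y} → InGrid n m (x , y) → InGrid n m (x′ , y) → Walk n m E F ∣ x - x′ ∣ (x , y) (x′ , y)
  row-walk {x} {x′} x∈G x′∈G with ≤-total x′ x
  ... | inj₁ x′≤x = row-descent x∈G x′∈G x′≤x
  ... | inj₂ x≤x′ = subst (λ k → Walk n m E F k _ _) (∣-∣-comm x′ x) (reverse (row-descent x′∈G x∈G x≤x′))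

  column-walk : ∀ {x y y′} → InGrid n m (x , y) → InGrid n m (x , y′) → Walk n m E F ∣ y - y′ ∣ (x , y) (x , y′)
  column-walk {y = y} {y′} y∈G y′∈G with ≤-total y′ y
  ... | inj₁ y′≤y = column-descent y∈G y′∈G y′≤y
  ... | inj₂ y≤y′ = subst (λ k → Walk n m E F k _ _) (∣-∣-comm y′ y) (reverse (column-descent y′∈G y∈G y≤y′))

  grid-walk : ∀ {A B} → InGrid n m A → InGrid n m B → Walk n m E F (d₁ A B) A B
  grid-walk (x∈ , y∈) (x′∈ , y′∈) = row-walk (x∈ , y∈) (x′∈ , y∈) ++ᵂ column-walk (x′∈ , y∈) (x′∈ , y′∈)

  walk-⊓ : ∀ {k j u w} → Walk n m E F k u w → Walk n m E F j u w → Walk n m E F (k ⊓ j) u w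
  walk-⊓ {k} {j} p q with ⊓-sel k j
  ... | inj₁ k⊓j≡k rewrite k⊓j≡k = p
  ... | inj₂ k⊓j≡j rewrite k⊓j≡j = q

  potential-bound : (f : Point → ℕ) → (∀ {u v} → Adj' n m E F u v → f u ≤ suc (f v)) →
                    ∀ {k u w} → Walk n m E F k u w → f u ≤ k + f w
  potential-bound f f-step (here _) = ≤-refl
  potential-bound f f-step (step uv p) = ≤-trans (f-step uv) (s≤s (potential-bound f f-step p))

-- Distances in G'

module Shortcut {n m : ℕ} {E F : Point} (E∈G : InGrid n m E) (F∈G : InGrid n m F) where
  open Walks n m E F

  d' : Point → Point → ℕ
  d' A X = (d₁ A X ⊓ via E F A X) ⊓ via F E A X

  d'≤d₁ : ∀ A X → d' A X ≤ d₁ A X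
  d'≤d₁ A X = ≤-trans (m⊓n≤m _ _) (m⊓n≤m _ _)

  d'≤via-EF : ∀ A X → d' A X ≤ via E F A X
  d'≤via-EF A X = ≤-trans (m⊓n≤m _ _) (m⊓n≤n _ _)

  d'≤via-FE : ∀ A X → d' A X ≤ via F E A X
  d'≤via-FE A X = m⊓n≤n _ _

  d'-self : ∀ X → d' X X ≡ 0
  d'-self X = n≤0⇒n≡0 (≤-trans (d'≤d₁ X X) (≤-reflexive (d₁-self X)))

  d'-walk : ∀ {A X} → InGrid n m A → InGrid n m X → Walk n m E F (d' A X) A X
  d'-walk {A} {X} A∈G X∈G =
    walk-⊓ (walk-⊓ (grid-walk A∈G X∈G) (detour E∈G F∈G (inj₁ (refl , refl))))
           (detour F∈G E∈G (inj₂ (refl , refl)))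
    where
    detour : ∀ {P Q} → InGrid n m P → InGrid n m Q → ((P ≡ E × Q ≡ F) ⊎ (P ≡ F × Q ≡ E)) →
             Walk n m E F (via P Q A X) A X
    detour P∈G Q∈G PQ = grid-walk A∈G P∈G ++ᵂ step (P∈G , Q∈G , inj₂ PQ) (grid-walk Q∈G X∈G)

  d'-E≤ : ∀ X → d' E X ≤ suc (d₁ F X)
  d'-E≤ X = ≤-trans (d'≤via-EF E X) (≤-reflexive (cong (_+ suc (d₁ F X)) (d₁-self E)))

  d'-F≤ : ∀ X → d' F X ≤ suc (d₁ E X)
  d'-F≤ X = ≤-trans (d'≤via-FE F X) (≤-reflexive (cong (_+ suc (d₁ E X)) (d₁-self F)))

  ≤-suc-d' : ∀ {t} Q X → t ≤ suc (d₁ Q X) → t ≤ suc (d₁ E X) → t ≤ suc (d₁ F X) → t ≤ suc (d' Q X)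
  ≤-suc-d' Q X t≤Q t≤E t≤F =
    ⊓-glb (⊓-glb t≤Q (≤-trans t≤F (s≤s (d₁≤via E F Q X)))) (≤-trans t≤E (s≤s (d₁≤via F E Q X)))

  d'-step : ∀ X {u v} → Adj' n m E F u v → d' u X ≤ suc (d' v X)
  d'-step X (_ , _ , inj₁ uv) =
    ⊓-mono-≤ (⊓-mono-≤ (d₁-step uv X) (+-monoˡ-≤ _ (d₁-step uv E))) (+-monoˡ-≤ _ (d₁-step uv F))
  d'-step X (_ , _ , inj₂ (inj₁ (refl , refl))) =
    ≤-suc-d' F X (d'-E≤ X) (≤-trans (d'≤d₁ E X) (n≤1+n _)) (d'-E≤ X)
  d'-step X (_ , _ , inj₂ (inj₂ (refl , refl))) =
    ≤-suc-d' E X (d'-F≤ X) (d'-F≤ X) (≤-trans (d'≤d₁ F X) (n≤1+n _))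

  d'-is-distance : ∀ {A X} → InGrid n m A → InGrid n m X → Dist n m E F A X (d' A X)
  d'-is-distance {A} {X} A∈G X∈G = d'-walk A∈G X∈G , shortest
    where
    shortest : ∀ k → Walk n m E F k A X → d' A X ≤ k
    shortest k w = begin
      d' A X       ≤⟨ potential-bound (λ u → d' u X) (d'-step X) w ⟩
      k + d' X X   ≡⟨ cong (k +_) (d'-self X) ⟩
      k + 0        ≡⟨ +-identityʳ k ⟩
      k            ∎
      where open ≤-Reasoning

  d'-routes : ∀ A X → d' A X ≡ d₁ A X ⊎ d' A X ≡ via E F A X ⊎ d' A X ≡ via F E A X
  d'-routes A X with ⊓-sel (d₁ A X ⊓ via E F A X) (via F E A X)
  ... | inj₂ eq = inj₂ (inj₂ eq)
  ... | inj₁ eq with ⊓-sel (d₁ A X) (via E F A X)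
  ...   | inj₁ eq′ = inj₁ (trans eq eq′)
  ...   | inj₂ eq′ = inj₂ (inj₁ (trans eq eq′))

  d'≢longer-via : ∀ P Q A X → d₁ A X < via P Q A X → d' A X ≢ via P Q A X
  d'≢longer-via P Q A X d₁<v eq = <⇒≱ d₁<v (subst (_≤ d₁ A X) eq (d'≤d₁ A X))

  d'-F-nearer : ∀ {X} → d₁ F X ≤ d₁ E X → ∀ A → d' A X ≡ d₁ A X ⊎ d' A X ≡ via E F A X
  d'-F-nearer {X} F≤E A with d'-routes A X
  ... | inj₁ eq = inj₁ eq
  ... | inj₂ (inj₁ eq) = inj₂ eq
  ... | inj₂ (inj₂ eq) = ⊥-elim (d'≢longer-via F E A X (d₁<via F E A X F≤E) eq)

  d'-E-nearer : ∀ {X} → d₁ E X ≤ d₁ F X → ∀ A → d' A X ≡ d₁ A X ⊎ d' A X ≡ via F E A X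
  d'-E-nearer {X} E≤F A with d'-routes A X
  ... | inj₁ eq = inj₁ eq
  ... | inj₂ (inj₁ eq) = ⊥-elim (d'≢longer-via E F A X (d₁<via E F A X E≤F) eq)
  ... | inj₂ (inj₂ eq) = inj₂ eq

  d'-equidistant : ∀ {X} → d₁ E X ≡ d₁ F X → ∀ A → d' A X ≡ d₁ A X
  d'-equidistant {X} E≡F A with d'-F-nearer (≤-reflexive (sym E≡F)) A
  ... | inj₁ eq = eq
  ... | inj₂ eq = ⊥-elim (d'≢longer-via E F A X (d₁<via E F A X (≤-reflexive E≡F)) eq)

  at-most-one-detour : ∀ A X Y → d' A X ≡ via E F A X → d' A Y ≡ via F E A Y → ⊥
  at-most-one-detour A X Y eqˣ eqʸ = <⇒≱ longer shorter
    where
    shorter : via E F A X + via F E A Y ≤ d₁ A X + d₁ A Y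
    shorter = +-mono-≤ (subst (_≤ d₁ A X) eqˣ (d'≤d₁ A X)) (subst (_≤ d₁ A Y) eqʸ (d'≤d₁ A Y))
    regroup : ∀ p q r s → suc (suc ((p + q) + (r + s))) ≡ (r + suc q) + (p + suc s)
    regroup = solve-∀
    longer : d₁ A X + d₁ A Y < via E F A X + via F E A Y
    longer = begin-strict
      d₁ A X + d₁ A Y                           ≤⟨ +-mono-≤ (d₁-triangle A F X) (d₁-triangle A E Y) ⟩
      (d₁ A F + d₁ F X) + (d₁ A E + d₁ E Y)     <⟨ n<1+n _ ⟩
      suc ((d₁ A F + d₁ F X) + (d₁ A E + d₁ E Y)) <⟨ n<1+n _ ⟩
      suc (suc ((d₁ A F + d₁ F X) + (d₁ A E + d₁ E Y))) ≡⟨ regroup (d₁ A F) (d₁ F X) (d₁ A E) (d₁ E Y) ⟩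
      via E F A X + via F E A Y                 ∎
      where open ≤-Reasoning

  same-route : ∀ {P Q A B X} → colour P ≡₂ colour Q → colour A ≡₂ colour B → d' A X ≡ d' B X →
    d' A X ≡ d₁ A X ⊎ d' A X ≡ via P Q A X → d' B X ≡ d₁ B X ⊎ d' B X ≡ via P Q B X →
    d₁ A X ≡ d₁ B X ⊎ (d' A X ≡ via P Q A X × d' B X ≡ via P Q B X)
  same-route _ _ eq (inj₁ eqᴬ) (inj₁ eqᴮ) = inj₁ (trans (sym eqᴬ) (trans eq eqᴮ))
  same-route _ _ _ (inj₂ eqᴬ) (inj₂ eqᴮ) = inj₂ (eqᴬ , eqᴮ)
  same-route {P} {Q} {A} {B} {X} P≡Q A≡B eq (inj₁ eqᴬ) (inj₂ eqᴮ) =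
    ⊥-elim (d₁≢via {P} {Q} {A} {B} {X} P≡Q A≡B (trans (sym eqᴬ) (trans eq eqᴮ)))
  same-route {P} {Q} {A} {B} {X} P≡Q A≡B eq (inj₂ eqᴬ) (inj₁ eqᴮ) =
    ⊥-elim (d₁≢via {P} {Q} {B} {A} {X} P≡Q (≡₂-sym A≡B) (trans (sym eqᴮ) (trans (sym eq) eqᴬ)))

  resolving-if-separating : ∀ R → All (InGrid n m) R →
    (∀ {A B} → InGrid n m A → InGrid n m B → All (λ X → d' A X ≡ d' B X) R → A ≡ B) →
    Resolving n m E F R
  resolving-if-separating R R∈G separates A B A∈G B∈G A≢B
    with find (¬All⇒Any¬ (λ X → d' A X ≟ d' B X) R (A≢B ∘ separates A∈G B∈G))
  ... | X , X∈R , d'≢ =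
    X , X∈R , d' A X , d' B X , d'-is-distance A∈G (lookup R∈G X∈R) , d'-is-distance B∈G (lookup R∈G X∈R) , d'≢

-- x_F = a, x_E − x_F = d, y_E = c and (y_F − y_E) − d = 2k, so that ⌊β₀⌋ = b.
module Configuration (a′ d e c k m : ℕ) (1≤c : 1 ≤ c) (1≤k : 1 ≤ k) (b+k≤m : c + d + k + k ≤ m) where
  a n b : ℕ
  a = suc a′
  n = a + d + e
  b = c + d + k

  E F X₁ X₂ X₃ : Point
  E = (a + d , c)
  F = (a , b + k)
  X₁ = (1 , b)
  X₂ = (n , b)
  X₃ = (n , 1)

  c≤b : c ≤ b
  c≤b = ≤-trans (m≤m+n c d) (m≤m+n (c + d) k)

  b<b+k : b < b + k
  b<b+k = m<m+n b 1≤k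

  c≤b+k : c ≤ b + k
  c≤b+k = ≤-trans c≤b (<⇒≤ b<b+k)

  E∈G : InGrid n m E
  E∈G = (s≤s z≤n , m≤m+n (a + d) e) , (1≤c , ≤-trans c≤b+k b+k≤m)

  F∈G : InGrid n m F
  F∈G = (s≤s z≤n , ≤-trans (m≤m+n a d) (m≤m+n (a + d) e)) , (≤-trans 1≤c c≤b+k , b+k≤m)

  X₁∈G : InGrid n m X₁
  X₁∈G = (s≤s z≤n , s≤s z≤n) , (≤-trans 1≤c c≤b , ≤-trans (<⇒≤ b<b+k) b+k≤m)

  X₂∈G : InGrid n m X₂
  X₂∈G = (s≤s z≤n , ≤-refl) , (≤-trans 1≤c c≤b , ≤-trans (<⇒≤ b<b+k) b+k≤m)

  X₃∈G : InGrid n m X₃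
  X₃∈G = (s≤s z≤n , ≤-refl) , (s≤s z≤n , ≤-trans 1≤c (≤-trans c≤b+k b+k≤m))

  ∣c-b∣ : ∣ c - b ∣ ≡ d + k
  ∣c-b∣ = trans (cong (λ z → ∣ c - z ∣) (+-assoc c d k)) (∣m-m+n∣≡n c (d + k))

  ∣a+d-n∣ : ∣ a + d - n ∣ ≡ e
  ∣a+d-n∣ = ∣m-m+n∣≡n (a + d) e

  ∣a-n∣ : ∣ a - n ∣ ≡ d + e
  ∣a-n∣ = trans (cong (λ z → ∣ a - z ∣) (+-assoc a d e)) (∣m-m+n∣≡n a (d + e))

  d₁-F-X₁ : d₁ F X₁ ≡ a′ + k
  d₁-F-X₁ = cong₂ _+_ (∣-∣-identityʳ a′) (∣m+n-m∣≡n b k)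

  X₂-equidistant : d₁ E X₂ ≡ d₁ F X₂
  X₂-equidistant = begin
    ∣ a + d - n ∣ + ∣ c - b ∣   ≡⟨ cong₂ _+_ ∣a+d-n∣ ∣c-b∣ ⟩
    e + (d + k)                 ≡⟨ regroup e d k ⟩
    (d + e) + k                 ≡⟨ cong₂ _+_ ∣a-n∣ (∣m+n-m∣≡n b k) ⟨
    ∣ a - n ∣ + ∣ b + k - b ∣   ∎
    where
    open ≡-Reasoning
    regroup : ∀ e d k → e + (d + k) ≡ (d + e) + k
    regroup = solve-∀

  F-nearer-X₁ : d₁ F X₁ ≤ d₁ E X₁
  F-nearer-X₁ = begin
    d₁ F X₁              ≡⟨ d₁-F-X₁ ⟩
    a′ + k               ≤⟨ +-mono-≤ (m≤m+n a′ d) (m≤n+m k d) ⟩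
    (a′ + d) + (d + k)   ≡⟨ cong₂ _+_ (∣-∣-identityʳ (a′ + d)) ∣c-b∣ ⟨
    d₁ E X₁              ∎
    where open ≤-Reasoning

  E-nearer-X₃ : d₁ E X₃ ≤ d₁ F X₃
  E-nearer-X₃ = begin
    ∣ a + d - n ∣ + ∣ c - 1 ∣   ≡⟨ cong₂ _+_ ∣a+d-n∣ (m≤n⇒∣n-m∣≡n∸m 1≤c) ⟩
    e + (c ∸ 1)                 ≤⟨ +-mono-≤ (m≤n+m e d) (∸-monoˡ-≤ 1 c≤b+k) ⟩
    (d + e) + (b + k ∸ 1)       ≡⟨ cong₂ _+_ ∣a-n∣ (m≤n⇒∣n-m∣≡n∸m (≤-trans 1≤c c≤b+k)) ⟨
    ∣ a - n ∣ + ∣ b + k - 1 ∣   ∎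
    where open ≤-Reasoning

  E-F-same-colour : colour E ≡₂ colour F
  E-F-same-colour = begin
    a + d + c              ≈⟨ +-double-≡₂ (a + d + c) k ⟨
    a + d + c + (k + k)    ≡⟨ regroup a d c k ⟩
    a + (c + d + k + k)    ∎
    where
    open ≡₂-Reasoning
    regroup : ∀ a d c k → a + d + c + (k + k) ≡ a + (c + d + k + k)
    regroup = solve-∀

  open Shortcut E∈G F∈G

  detour-to-X₁⇒y≤b : ∀ {x y} → d' (x , y) X₁ ≡ via E F (x , y) X₁ → y ≤ b
  detour-to-X₁⇒y≤b {x} {y} detour with y ≤? b
  ... | yes y≤b = y≤b
  ... | no y≰b = contradiction (subst (_≤ d₁ (x , y) X₁) detour (d'≤d₁ (x , y) X₁)) (<⇒≱ (direct-shorter (≰⇒≥ y≰b)))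
    where
    u : ℕ
    u = ∣ x - (a + d) ∣
    regroup : ∀ u a′ d k v → suc ((u + (a′ + d)) + v + (k + k)) ≡ (u + ((d + k) + v)) + suc (a′ + k)
    regroup = solve-∀
    direct-shorter : b ≤ y → d₁ (x , y) X₁ < via E F (x , y) X₁
    direct-shorter b≤y = begin-strict
      ∣ x - 1 ∣ + ∣ y - b ∣                        ≤⟨ +-monoˡ-≤ ∣ y - b ∣ (∣-∣-triangle x (a + d) 1) ⟩
      (u + ∣ a′ + d - 0 ∣) + ∣ y - b ∣             ≡⟨ cong (λ z → (u + z) + ∣ y - b ∣) (∣-∣-identityʳ (a′ + d)) ⟩
      (u + (a′ + d)) + ∣ y - b ∣                   <⟨ s≤s (m≤m+n _ (k + k)) ⟩
      suc ((u + (a′ + d)) + ∣ y - b ∣ + (k + k))   ≡⟨ regroup u a′ d k ∣ y - b ∣ ⟩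
      (u + ((d + k) + ∣ y - b ∣)) + suc (a′ + k)   ≡⟨ cong₂ (λ p q → (u + p) + suc q) ∣y-c∣ d₁-F-X₁ ⟨
      (u + ∣ y - c ∣) + suc (d₁ F X₁)              ∎
      where
      open ≤-Reasoning
      ∣y-c∣ : ∣ y - c ∣ ≡ (d + k) + ∣ y - b ∣
      ∣y-c∣ = begin-equality
        ∣ y - c ∣               ≡⟨ ∣-∣-comm y c ⟩
        ∣ c - y ∣               ≡⟨ ∣x-l∣+∣x-h∣≡∣l-h∣ c≤b b≤y ⟨
        ∣ b - c ∣ + ∣ b - y ∣   ≡⟨ cong₂ _+_ (trans (∣-∣-comm b c) ∣c-b∣) (∣-∣-comm b y) ⟩
        (d + k) + ∣ y - b ∣     ∎

  recover : ∀ {x y x′ y′} → InGrid n m (x , y) → InGrid n m (x′ , y′) →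
    d₁ (x , y) X₂ ≡ d₁ (x′ , y′) X₂ → d' (x , y) X₃ ≡ d' (x′ , y′) X₃ →
    d₁ (x , y) X₁ ≡ d₁ (x′ , y′) X₁ ⊎ (d' (x , y) X₁ ≡ via E F (x , y) X₁ × d' (x′ , y′) X₁ ≡ via E F (x′ , y′) X₁) →
    d₁ (x , y) X₃ ≡ d₁ (x′ , y′) X₃ ⊎ (d' (x , y) X₃ ≡ via F E (x , y) X₃ × d' (x′ , y′) X₃ ≡ via F E (x′ , y′) X₃) →
    (x , y) ≡ (x′ , y′)
  recover {x} ((1≤x , x≤n) , (1≤y , _)) ((1≤x′ , x′≤n) , (1≤y′ , _)) eq₂ _ (inj₁ eq₁) (inj₁ eq₃)
    with segment-landmarks 1≤x x≤n 1≤x′ x′≤n eq₁ eq₂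
  ... | refl , _ = cong (x ,_) (∣-∣-cancel-≥ 1≤y 1≤y′ (+-cancelˡ-≡ ∣ x - n ∣ _ _ eq₃))
  recover {x} {y} {x′} {y′} ((1≤x , x≤n) , _) ((1≤x′ , x′≤n) , _) eq₂ e₃ (inj₁ eq₁) (inj₂ (via₃ , via₃′))
    with segment-landmarks 1≤x x≤n 1≤x′ x′≤n eq₁ eq₂
  ... | refl , ∣y-b∣≡∣y′-b∣ = cong (x ,_) (two-centres-injective b<b+k ∣y-b∣≡∣y′-b∣ ∣y-b-k∣≡∣y′-b-k∣)
    where
    ∣y-b-k∣≡∣y′-b-k∣ : ∣ y - b + k ∣ ≡ ∣ y′ - b + k ∣
    ∣y-b-k∣≡∣y′-b-k∣ =
      +-cancelˡ-≡ ∣ x - a ∣ _ _ (+-cancelʳ-≡ (suc (d₁ E X₃)) _ _ (trans (sym via₃) (trans e₃ via₃′)))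
  recover {x} {y} {x′} {y′} ((_ , x≤n) , (1≤y , _)) ((_ , x′≤n) , (1≤y′ , _)) eq₂ _ (inj₂ (via₁ , via₁′)) (inj₁ eq₃)
    with segment-landmarks 1≤y (detour-to-X₁⇒y≤b {x} via₁) 1≤y′ (detour-to-X₁⇒y≤b {x′} via₁′)
           (+-comm-≡ ∣ x - n ∣ ∣ y - 1 ∣ ∣ x′ - n ∣ ∣ y′ - 1 ∣ eq₃) (+-comm-≡ ∣ x - n ∣ ∣ y - b ∣ ∣ x′ - n ∣ ∣ y′ - b ∣ eq₂)
  ... | refl , ∣x-n∣≡∣x′-n∣ = cong (_, y) (∣-∣-cancel-≤ x≤n x′≤n ∣x-n∣≡∣x′-n∣)
  recover {x} {y} _ _ _ _ (inj₂ (via₁ , _)) (inj₂ (via₃ , _)) = ⊥-elim (at-most-one-detour (x , y) X₁ X₃ via₁ via₃)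

  resolving : Resolving n m E F (X₁ ∷ X₂ ∷ X₃ ∷ [])
  resolving = resolving-if-separating (X₁ ∷ X₂ ∷ X₃ ∷ []) (X₁∈G ∷ X₂∈G ∷ X₃∈G ∷ []) separates
    where
    separates : ∀ {A B} → InGrid n m A → InGrid n m B → All (λ X → d' A X ≡ d' B X) (X₁ ∷ X₂ ∷ X₃ ∷ []) → A ≡ B
    separates {A} {B} A∈G B∈G (e₁ ∷ e₂ ∷ e₃ ∷ []) =
      recover A∈G B∈G eq₂ e₃
        (same-route {E} {F} {A} {B} {X₁} E-F-same-colour A≡₂B e₁ (d'-F-nearer F-nearer-X₁ A) (d'-F-nearer F-nearer-X₁ B))
        (same-route {F} {E} {A} {B} {X₃} (≡₂-sym E-F-same-colour) A≡₂B e₃ (d'-E-nearer E-nearer-X₃ A) (d'-E-nearer E-nearer-X₃ B))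
      where
      eq₂ : d₁ A X₂ ≡ d₁ B X₂
      eq₂ = trans (sym (d'-equidistant X₂-equidistant A)) (trans e₂ (d'-equidistant X₂-equidistant B))
      A≡₂B : colour A ≡₂ colour B
      A≡₂B = d₁-equal⇒same-colour {A} {B} {X₂} eq₂

resolving-by-coordinates : ∀ {n m xE yE xF yF β} a′ d e k →
  xF ≡ suc a′ → xE ≡ xF + d → n ≡ xE + e → yF ≡ yE + d + k + k → β ≡ yE + d + k →
  1 ≤ yE → 1 ≤ k → yF ≤ m →
  Resolving n m (xE , yE) (xF , yF) ((1 , β) ∷ (n , β) ∷ (n , 1) ∷ [])
resolving-by-coordinates a′ d e k refl refl refl refl refl 1≤yE 1≤k yF≤m =
  Configuration.resolving a′ d e _ k _ 1≤yE 1≤k yF≤m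

-- Arithmetic of the hypotheses

∸1≡suc⇒ : ∀ {r s} → r ∸ 1 ≡ suc s → r ≡ suc (suc s)
∸1≡suc⇒ {suc r} refl = refl

Gain'≡ : ∀ {xE yE xF yF} → xF ≤ xE → yE ≤ yF → xE ∸ xF ≤ yF ∸ yE →
  Gain' (xE , yE) (xF , yF) ≡ (yF ∸ yE) ∸ (xE ∸ xF) ∸ 1
Gain'≡ {xE} {yE} {xF} {yF} xF≤xE yE≤yF Δx≤Δy = cong (_∸ 1) (begin
  ∣ ∣ yF - yE ∣ - ∣ xE - xF ∣ ∣   ≡⟨ cong₂ ∣_-_∣ (m≤n⇒∣n-m∣≡n∸m yE≤yF) (m≤n⇒∣n-m∣≡n∸m xF≤xE) ⟩
  ∣ yF ∸ yE - xE ∸ xF ∣           ≡⟨ m≤n⇒∣n-m∣≡n∸m Δx≤Δy ⟩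
  (yF ∸ yE) ∸ (xE ∸ xF)           ∎)
  where open ≡-Reasoning

odd-Gain'⇒yF≡ : ∀ {xE yE xF yF} → xF ≤ xE → yE ≤ yF → xE ∸ xF ≤ yF ∸ yE →
  Gain' (xE , yE) (xF , yF) % 2 ≡ 1 → Σ[ j ∈ ℕ ] yF ≡ yE + (xE ∸ xF) + suc j + suc j
odd-Gain'⇒yF≡ {xE} {yE} {xF} {yF} xF≤xE yE≤yF Δx≤Δy odd = j , (begin
  yF                              ≡⟨ m+[n∸m]≡n yE≤yF ⟨
  yE + Δy                         ≡⟨ cong (yE +_) (m+[n∸m]≡n Δx≤Δy) ⟨
  yE + (Δx + (Δy ∸ Δx))           ≡⟨ cong (λ r → yE + (Δx + r)) (∸1≡suc⇒ Δy∸Δx∸1≡) ⟩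
  yE + (Δx + suc (suc (j * 2)))   ≡⟨ regroup yE Δx j ⟩
  yE + Δx + suc j + suc j         ∎)
  where
  open ≡-Reasoning
  Δx Δy g j : ℕ
  Δx = xE ∸ xF
  Δy = yF ∸ yE
  g = Gain' (xE , yE) (xF , yF)
  j = g / 2
  Δy∸Δx∸1≡ : Δy ∸ Δx ∸ 1 ≡ suc (j * 2)
  Δy∸Δx∸1≡ = begin
    Δy ∸ Δx ∸ 1     ≡⟨ Gain'≡ xF≤xE yE≤yF Δx≤Δy ⟨
    g               ≡⟨ m≡m%n+[m/n]*n g 2 ⟩
    g % 2 + j * 2   ≡⟨ cong (_+ j * 2) odd ⟩
    suc (j * 2)     ∎
  regroup : ∀ y x j → y + (x + suc (suc (j * 2))) ≡ y + x + suc j + suc j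
  regroup = solve-∀

floorβ₀≡ : ∀ {xE yE xF yF} k → yF ≡ yE + (xE ∸ xF) + k + k →
  floorβ₀ (xE , yE) (xF , yF) ≡ yE + (xE ∸ xF) + k
floorβ₀≡ {xE} {yE} {xF} {yF} k yF≡ = begin
  (1 + yF + yE + Δx) / 2                  ≡⟨ cong (λ y → (1 + y + yE + Δx) / 2) yF≡ ⟩
  (1 + (yE + Δx + k + k) + yE + Δx) / 2   ≡⟨ cong (_/ 2) (regroup yE Δx k) ⟩
  (1 + (yE + Δx + k) * 2) / 2             ≡⟨ +-distrib-/-∣ʳ 1 {(yE + Δx + k) * 2} {2} (n∣m*n (yE + Δx + k)) ⟩
  (yE + Δx + k) * 2 / 2                   ≡⟨ m*n/n≡m (yE + Δx + k) 2 ⟩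
  yE + Δx + k                             ∎
  where
  open ≡-Reasoning
  Δx : ℕ
  Δx = xE ∸ xF
  regroup : ∀ y x k → 1 + (y + x + k + k) + y + x ≡ 1 + (y + x + k) * 2
  regroup = solve-∀

lemma5 : (n m xE yE xF yF : ℕ) →
    InGrid n m (xE , yE) → InGrid n m (xF , yF) →
    xF ≤ xE → yE ≤ yF → xE ∸ xF ≤ yF ∸ yE → xF ≢ xE →
    2 ≤ Gain' (xE , yE) (xF , yF) →
    Interior n m (xE , yE) → Interior n m (xF , yF) →
    Gain' (xE , yE) (xF , yF) % 2 ≡ 1 →
    Resolving n m (xE , yE) (xF , yF)
      ((1 , floorβ₀ (xE , yE) (xF , yF)) ∷ (n , floorβ₀ (xE , yE) (xF , yF)) ∷ (n , 1) ∷ [])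
lemma5 n m xE yE xF yF ((_ , xE≤n) , (1≤yE , _)) ((1≤xF , _) , (_ , yF≤m)) xF≤xE yE≤yF Δx≤Δy _ _ _ _ odd
  with odd-Gain'⇒yF≡ xF≤xE yE≤yF Δx≤Δy odd
... | j , yF≡ =
  resolving-by-coordinates (xF ∸ 1) (xE ∸ xF) (n ∸ xE) (suc j)
    (sym (m+[n∸m]≡n 1≤xF)) (sym (m+[n∸m]≡n xF≤xE)) (sym (m+[n∸m]≡n xE≤n)) yF≡ (floorβ₀≡ {xE} {yE} {xF} {yF} (suc j) yF≡)
    1≤yE (s≤s z≤n) yF≤m
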